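{- Let $G$ be a simple bipartite graph with stable sets $X=\{x_i\}_{i=1}^s$ and $Y=\{y_j\}_{j=1}^t$, let $n\ge1$, and suppose $G\cong H_1\oplus H_2$ is a decomposition of $G$. If $G$ is edge-magic, then $S_{2n}(G;H_1,H_2)$ is edge-magic; if $G$ is super edge-magic, then $S_{2n}(G;H_1,H_2)$ is super edge-magic.
   Context: A decomposition $G\cong H_1\oplus H_2$ means $H_1,H_2$ are subgraphs of $G$ whose edge sets partition $E(G)$. An edge-magic labeling of a graph with $p$ vertices and $q$ edges is a bijection $f:V\cup E\to\{1,\dots,p+q\}$ such that $f(x)+f(xy)+f(y)$ is constant over all edges $xy$; it is super edge-magic if moreover $f(V)=\{1,\dots,p\}$. $S_{2n}(G;H_1,H_2)$ is the graph with vertex set $X\cup Y\cup\bigcup_{k=1}^n X_k\cup\bigcup_{k=1}^n Y_k$, where $X_k=\{x_i^k\}_{i=1}^s$, $Y_k=\{y_j^k\}_{j=1}^t$ are new vertices, and edge set $E(G)\cup\{x_iy_j^k: x_iy_j\in E(H_1),\,1\le k\le n\}\cup\{x_i^ky_j: x_iy_j\in E(H_2),\,1\le k\le n\}$. -}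

module Defs where

open import Data.Nat using (ℕ; _+_; _≤_)
open import Data.Fin using (Fin)
open import Data.Bool using (Bool; true; false; _∨_; _∧_)
open import Data.Product using (Σ; ∃; _×_; _,_; proj₁; proj₂)
open import Data.Sum using (_⊎_; inj₁; inj₂)
open import Relation.Binary.PropositionalEquality using (_≡_)
open import Function.Bundles using (_↔_)

record Graph : Set₁ where
  field
    V    : Set
    E    : Set
    ends : E → V × V
open Graph public

record EdgeMagicLabeling (G : Graph) (p q : ℕ) : Set where
  field
    f          : V G ⊎ E G → ℕ
    injective  : ∀ a b → f a ≡ f b → a ≡ b
    inRange    : ∀ a → 1 ≤ f a × f a ≤ p + q
    onto       : ∀ m → 1 ≤ m → m ≤ p + q → ∃ λ a → f a ≡ m
    magic      : ∃ λ k → ∀ e →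
                   f (inj₁ (proj₁ (ends G e))) + f (inj₂ e) + f (inj₁ (proj₂ (ends G e))) ≡ k

EdgeMagic : Graph → Set
EdgeMagic G = Σ ℕ λ p → Σ ℕ λ q →
  (V G ↔ Fin p) × (E G ↔ Fin q) × EdgeMagicLabeling G p q

SuperEdgeMagic : Graph → Set
SuperEdgeMagic G = Σ ℕ λ p → Σ ℕ λ q →
  (V G ↔ Fin p) × (E G ↔ Fin q) × Σ (EdgeMagicLabeling G p q) λ L →
    let f = EdgeMagicLabeling.f L in
    (∀ v → 1 ≤ f (inj₁ v) × f (inj₁ v) ≤ p) ×
    (∀ m → 1 ≤ m → m ≤ p → ∃ λ v → f (inj₁ v) ≡ m)

-- A simple bipartite graph with stable sets X = {x_i}_{i<s}, Y = {y_j}_{j<t}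
-- given by its adjacency  A i j = true  iff  x_i y_j ∈ E(G).
-- Edge set of a bipartite "edge set" A:
BEdges : {s t : ℕ} → (Fin s → Fin t → Bool) → Set
BEdges {s} {t} A = Σ (Fin s × Fin t) λ ij → A (proj₁ ij) (proj₂ ij) ≡ true

BipGraph : (s t : ℕ) → (Fin s → Fin t → Bool) → Graph
BipGraph s t A = record
  { V    = Fin s ⊎ Fin t
  ; E    = BEdges A
  ; ends = λ e → inj₁ (proj₁ (proj₁ e)) , inj₂ (proj₂ (proj₁ e))
  }

Decomposition : {s t : ℕ} → (A h1 h2 : Fin s → Fin t → Bool) → Set
Decomposition A h1 h2 = ∀ i j → (A i j ≡ (h1 i j ∨ h2 i j)) × (h1 i j ∧ h2 i j ≡ false)

-- Vertices: inj₁ v  is an original vertex (x_i or y_j);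
-- inj₂ (k , inj₁ i) is x_i^k and inj₂ (k , inj₂ j) is y_j^k.
-- Edges: those of G, plus  x_i y_j^k  for x_i y_j ∈ E(H1), plus  x_i^k y_j  for x_i y_j ∈ E(H2).
S2n : (s t n : ℕ) → (A h1 h2 : Fin s → Fin t → Bool) → Graph
S2n s t n A h1 h2 = record
  { V    = (Fin s ⊎ Fin t) ⊎ (Fin n × (Fin s ⊎ Fin t))
  ; E    = BEdges A ⊎ ((Fin n × BEdges h1) ⊎ (Fin n × BEdges h2))
  ; ends = ends′
  }
  where
  ends′ : BEdges A ⊎ ((Fin n × BEdges h1) ⊎ (Fin n × BEdges h2)) →
          ((Fin s ⊎ Fin t) ⊎ (Fin n × (Fin s ⊎ Fin t))) × ((Fin s ⊎ Fin t) ⊎ (Fin n × (Fin s ⊎ Fin t)))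
  ends′ (inj₁ e) = inj₁ (inj₁ (proj₁ (proj₁ e))) , inj₁ (inj₂ (proj₂ (proj₁ e)))
  ends′ (inj₂ (inj₁ (k , e))) = inj₁ (inj₁ (proj₁ (proj₁ e))) , inj₂ (k , inj₂ (proj₂ (proj₁ e)))
  ends′ (inj₂ (inj₂ (k , e))) = inj₂ (k , inj₁ (proj₁ (proj₁ e))) , inj₁ (inj₂ (proj₂ (proj₁ e)))

module Submission where

-- S_{2n}(G;H₁,H₂) is an (n+1)-layered cover of G: its vertices and edges
-- are those of G tagged with a layer 0,…,n (layer 0 is G itself; layer k+1 holds the
-- copies x_i^k, y_j^k and the copied edges at them), every edge lies over an edge of G
-- with its ends over the ends of that edge, and the layers of the ends add up to the
-- layer of the edge.  If f is an edge-magic labeling of G by 1,…,N, label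
--   a vertex over v in layer a   by  (n+1)(f v − 1) + a + 1,
--   an edge over e in layer c    by  (n+1)(f e − 1) + (n − c) + 1.
-- These are the numbers 1,…,N(n+1) written in mixed radix, so each is used exactly
-- once; every edge sum is (n+1)(k − 3) + n + 3 for the magic constant k of f; and if f
-- is super, the vertex labels are exactly 1,…,p(n+1).

open import Defs
open import Data.Nat using (ℕ; suc; pred; >-nonZero; _+_; _*_; _∸_; _≤_; s≤s; z≤n)
open import Data.Nat.Properties
  using (suc-pred; suc-injective; +-suc; +-identityʳ; *-distribʳ-+; m+[n∸m]≡n; ≤-pred)
open import Data.Nat.Tactic.RingSolver using (solve-∀)
open import Data.Fin using (Fin; toℕ; fromℕ<; combine; opposite) renaming (zero to fzero; suc to fsuc)
open import Data.Fin.Properties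
  using (toℕ-injective; toℕ-fromℕ<; toℕ<n; toℕ-combine; opposite-prop; opposite-involutive; *↔×)
open import Data.Bool using (Bool; true; false; _∨_; _∧_)
open import Data.Bool.Properties using (∨-zeroʳ) renaming (_≟_ to _≟ᵇ_)
open import Data.Product using (Σ; ∃; _×_; _,_; proj₁; proj₂)
open import Data.Product.Algebra using (×-distribʳ-⊎)
open import Data.Product.Function.NonDependent.Propositional using (_×-↔_)
open import Data.Sum using (_⊎_; inj₁; inj₂)
open import Data.Sum.Properties using (inj₁-injective)
open import Data.Sum.Function.Propositional using (_⊎-↔_)
open import Function.Base using (_∘_)
open import Function.Bundles using (_↔_; Inverse; Injection; mk↔ₛ′)
open import Function.Properties.Inverse using (↔-trans; ↔-sym; ↔-refl; ↔⇒↣)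
open import Relation.Binary.PropositionalEquality
open import Axiom.UniquenessOfIdentityProofs using (module Decidable⇒UIP)

open Inverse using (to; from; strictlyInverseˡ)
open ≡-Reasoning

record Numbering {X : Set} (M : ℕ) (f : X → ℕ) : Set where
  field
    injective : ∀ a b → f a ≡ f b → a ≡ b
    inRange   : ∀ a → 1 ≤ f a × f a ≤ M
    onto      : ∀ m → 1 ≤ m → m ≤ M → ∃ λ a → f a ≡ m

numberingCode : {X : Set} {M : ℕ} {f : X → ℕ} → Numbering M f →
  Σ (X ↔ Fin M) λ c → ∀ a → suc (toℕ (to c a)) ≡ f a
numberingCode {X} {M} {f} numbering = mk↔ₛ′ code decode code∘decode decode∘code , codeSpec
  where
  open Numbering numbering

  unshift : ∀ a → suc (pred (f a)) ≡ f a
  unshift a = suc-pred (f a) {{>-nonZero (proj₁ (inRange a))}}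

  code : X → Fin M
  code a = fromℕ< (subst (_≤ M) (sym (unshift a)) (proj₂ (inRange a)))

  codeSpec : ∀ a → suc (toℕ (code a)) ≡ f a
  codeSpec a = trans (cong suc (toℕ-fromℕ< _)) (unshift a)

  decode : Fin M → X
  decode i = proj₁ (onto (suc (toℕ i)) (s≤s z≤n) (toℕ<n i))

  decodeSpec : ∀ i → f (decode i) ≡ suc (toℕ i)
  decodeSpec i = proj₂ (onto (suc (toℕ i)) (s≤s z≤n) (toℕ<n i))

  code∘decode : ∀ i → code (decode i) ≡ i
  code∘decode i = toℕ-injective (suc-injective (trans (codeSpec (decode i)) (decodeSpec i)))

  decode∘code : ∀ a → decode (code a) ≡ a
  decode∘code a = injective _ _ (trans (decodeSpec (code a)) (codeSpec a))

codeNumbering : {X : Set} {M : ℕ} (c : X ↔ Fin M) (f : X → ℕ) →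
  (∀ a → f a ≡ suc (toℕ (to c a))) → Numbering M f
codeNumbering {M = M} c f spec = record
  { injective = λ a b eq → Injection.injective (↔⇒↣ c)
      (toℕ-injective (suc-injective (trans (sym (spec a)) (trans eq (spec b)))))
  ; inRange   = λ a → subst (λ ℓ → 1 ≤ ℓ × ℓ ≤ M) (sym (spec a)) (s≤s z≤n , toℕ<n (to c a))
  ; onto      = onto
  }
  where
  onto : ∀ m → 1 ≤ m → m ≤ M → ∃ λ a → f a ≡ m
  onto (suc m) _ m<M = from c i , (begin
    f (from c i)                 ≡⟨ spec (from c i) ⟩
    suc (toℕ (to c (from c i)))  ≡⟨ cong (suc ∘ toℕ) (strictlyInverseˡ c i) ⟩
    suc (toℕ i)                  ≡⟨ cong suc (toℕ-fromℕ< m<M) ⟩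
    suc m                        ∎)
    where i = fromℕ< m<M

layeredCount : {X X' : Set} {p S : ℕ} → X' ↔ (X × Fin S) → X ↔ Fin p → X' ↔ Fin (p * S)
layeredCount layers count = ↔-trans layers (↔-trans (count ×-↔ ↔-refl) (↔-sym *↔×))

-- The label of an element over a G-element labelled ℓ carrying the digit d < S:
-- the mixed-radix number (ℓ − 1, d), shifted by one.
digitLabel : ℕ → ℕ → ℕ → ℕ
digitLabel S ℓ d = suc (S * pred ℓ + d)

combineDigit : ∀ {N S} (i : Fin N) (d : Fin S) →
  suc (toℕ (combine i d)) ≡ digitLabel S (suc (toℕ i)) (toℕ d)
combineDigit i d = cong suc (toℕ-combine i d)

sumOfPreds : ∀ x e y → suc x + suc e + suc y ∸ 3 ≡ x + e + y
sumOfPreds x e y rewrite +-suc x e | +-suc (x + e) y = refl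

-- The edge sum of the lifted labeling: the vertex digits a, b and the edge digit
-- n − (a + b) add up to n, so the sum depends only on the sum of the G-labels.
liftedEdgeSum : ∀ n ℓx ℓe ℓy a b → 1 ≤ ℓx → 1 ≤ ℓe → 1 ≤ ℓy → a + b ≤ n →
  digitLabel (suc n) ℓx a + digitLabel (suc n) ℓe (n ∸ (a + b)) + digitLabel (suc n) ℓy b
    ≡ 3 + suc n * (ℓx + ℓe + ℓy ∸ 3) + n
liftedEdgeSum n (suc x) (suc e) (suc y) a b (s≤s _) (s≤s _) (s≤s _) a+b≤n = begin
  suc (S * x + a) + suc (S * e + (n ∸ (a + b))) + suc (S * y + b)
    ≡⟨ regroup S x e y a b (n ∸ (a + b)) ⟩
  3 + S * (x + e + y) + (a + b + (n ∸ (a + b)))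
    ≡⟨ cong₂ (λ u v → 3 + S * u + v) (sym (sumOfPreds x e y)) (m+[n∸m]≡n a+b≤n) ⟩
  3 + S * (suc x + suc e + suc y ∸ 3) + n
    ∎
  where
  S = suc n
  regroup : ∀ S x e y a b c →
    suc (S * x + a) + suc (S * e + c) + suc (S * y + b) ≡ 3 + S * (x + e + y) + (a + b + c)
  regroup = solve-∀

record LayeredCover (G G' : Graph) (n : ℕ) : Set where
  field
    vertexLayers : V G' ↔ (V G × Fin (suc n))
    edgeLayers   : E G' ↔ (E G × Fin (suc n))
    tailOver     : ∀ e → proj₁ (to vertexLayers (proj₁ (ends G' e))) ≡ proj₁ (ends G (proj₁ (to edgeLayers e)))
    headOver     : ∀ e → proj₁ (to vertexLayers (proj₂ (ends G' e))) ≡ proj₂ (ends G (proj₁ (to edgeLayers e)))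
    layersAdd    : ∀ e → toℕ (proj₂ (to vertexLayers (proj₁ (ends G' e))))
                         + toℕ (proj₂ (to vertexLayers (proj₂ (ends G' e))))
                         ≡ toℕ (proj₂ (to edgeLayers e))

module Transfer {G G' : Graph} {n : ℕ} (cover : LayeredCover G G' n) where
  open LayeredCover cover

  S : ℕ
  S = suc n

  baseV : V G' → V G
  baseV v = proj₁ (to vertexLayers v)

  layerV : V G' → ℕ
  layerV v = toℕ (proj₂ (to vertexLayers v))

  baseE : E G' → E G
  baseE e = proj₁ (to edgeLayers e)

  layerE : E G' → ℕ
  layerE e = toℕ (proj₂ (to edgeLayers e))

  digitsFit : ∀ e → layerV (proj₁ (ends G' e)) + layerV (proj₂ (ends G' e)) ≤ n
  digitsFit e = subst (_≤ n) (sym (layersAdd e)) (≤-pred (toℕ<n (proj₂ (to edgeLayers e))))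

  -- Edges carry their layer reversed, so that the digits along an edge add up to n.
  reverseDigits : Fin S ↔ Fin S
  reverseDigits = mk↔ₛ′ opposite opposite opposite-involutive opposite-involutive

  digits : (V G' ⊎ E G') ↔ ((V G ⊎ E G) × Fin S)
  digits = ↔-trans (vertexLayers ⊎-↔ ↔-trans edgeLayers (↔-refl ×-↔ reverseDigits))
                   (↔-sym (×-distribʳ-⊎ _ (Fin S) (V G) (E G)))

  module Lift {p q : ℕ} (L : EdgeMagicLabeling G p q) where
    open EdgeMagicLabeling L

    code : Σ ((V G ⊎ E G) ↔ Fin (p + q)) λ c → ∀ a → suc (toℕ (to c a)) ≡ f a
    code = numberingCode record { injective = injective ; inRange = inRange ; onto = onto }

    liftedCode : (V G' ⊎ E G') ↔ Fin ((p + q) * S)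
    liftedCode = layeredCount digits (proj₁ code)

    F : V G' ⊎ E G' → ℕ
    F w = suc (toℕ (to liftedCode w))

    liftedDigit : ∀ a (d : Fin S) → suc (toℕ (combine (to (proj₁ code) a) d)) ≡ digitLabel S (f a) (toℕ d)
    liftedDigit a d = trans (combineDigit (to (proj₁ code) a) d)
                            (cong (λ ℓ → digitLabel S ℓ (toℕ d)) (proj₂ code a))

    vertexLabel : ∀ v → F (inj₁ v) ≡ digitLabel S (f (inj₁ (baseV v))) (layerV v)
    vertexLabel v = liftedDigit (inj₁ (baseV v)) (proj₂ (to vertexLayers v))

    edgeLabel : ∀ e → F (inj₂ e) ≡ digitLabel S (f (inj₂ (baseE e))) (n ∸ layerE e)
    edgeLabel e = trans (liftedDigit (inj₂ (baseE e)) (opposite (proj₂ (to edgeLayers e))))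
                        (cong (digitLabel S (f (inj₂ (baseE e)))) (opposite-prop (proj₂ (to edgeLayers e))))

    liftedSum : V G → E G → V G → ℕ → ℕ → ℕ → ℕ
    liftedSum u ê w a b c = digitLabel S (f (inj₁ u)) a + digitLabel S (f (inj₂ ê)) (n ∸ c) + digitLabel S (f (inj₁ w)) b

    liftedMagic : ∃ λ k → ∀ e →
      F (inj₁ (proj₁ (ends G' e))) + F (inj₂ e) + F (inj₁ (proj₂ (ends G' e))) ≡ k
    liftedMagic with magic
    ... | k , isMagic = 3 + S * (k ∸ 3) + n , λ e →
      let x = proj₁ (ends G' e) ; y = proj₂ (ends G' e) ; ê = baseE e
          u = proj₁ (ends G ê) ; w = proj₂ (ends G ê) in begin
      F (inj₁ x) + F (inj₂ e) + F (inj₁ y)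
        ≡⟨ cong₂ _+_ (cong₂ _+_ (vertexLabel x) (edgeLabel e)) (vertexLabel y) ⟩
      liftedSum (baseV x) ê (baseV y) (layerV x) (layerV y) (layerE e)
        ≡⟨ cong₂ (λ u′ w′ → liftedSum u′ ê w′ (layerV x) (layerV y) (layerE e)) (tailOver e) (headOver e) ⟩
      liftedSum u ê w (layerV x) (layerV y) (layerE e)
        ≡⟨ cong (liftedSum u ê w (layerV x) (layerV y)) (sym (layersAdd e)) ⟩
      liftedSum u ê w (layerV x) (layerV y) (layerV x + layerV y)
        ≡⟨ liftedEdgeSum n _ _ _ (layerV x) (layerV y)
             (proj₁ (inRange _)) (proj₁ (inRange _)) (proj₁ (inRange _)) (digitsFit e) ⟩
      3 + S * (f (inj₁ u) + f (inj₂ ê) + f (inj₁ w) ∸ 3) + n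
        ≡⟨ cong (λ m → 3 + S * (m ∸ 3) + n) (isMagic ê) ⟩
      3 + S * (k ∸ 3) + n
        ∎

    liftedLabeling : EdgeMagicLabeling G' (p * S) (q * S)
    liftedLabeling = record
      { f = F ; injective = injective′ ; inRange = inRange′ ; onto = onto′ ; magic = liftedMagic }
      where
      open Numbering (subst (λ M → Numbering M F) (*-distribʳ-+ S p q)
                            (codeNumbering liftedCode F (λ _ → refl)))
        renaming (injective to injective′; inRange to inRange′; onto to onto′)

    liftedVertexNumbering : (∀ v → 1 ≤ f (inj₁ v) × f (inj₁ v) ≤ p) →
      (∀ m → 1 ≤ m → m ≤ p → ∃ λ v → f (inj₁ v) ≡ m) →
      Numbering (p * S) (F ∘ inj₁)
    liftedVertexNumbering vertexRange vertexOnto =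
      codeNumbering (layeredCount vertexLayers (proj₁ vertexCode)) (F ∘ inj₁) λ v →
        trans (vertexLabel v) (sym (trans (combineDigit _ (proj₂ (to vertexLayers v)))
          (cong (λ ℓ → digitLabel S ℓ (layerV v)) (proj₂ vertexCode (baseV v)))))
      where
      vertexCode : Σ (V G ↔ Fin p) λ c → ∀ v → suc (toℕ (to c v)) ≡ f (inj₁ v)
      vertexCode = numberingCode record
        { injective = λ u w eq → inj₁-injective (injective (inj₁ u) (inj₁ w) eq)
        ; inRange   = vertexRange
        ; onto      = vertexOnto
        }

  edgeMagic : EdgeMagic G → EdgeMagic G'
  edgeMagic (p , q , countV , countE , L) =
    p * S , q * S , layeredCount vertexLayers countV , layeredCount edgeLayers countE , Lift.liftedLabeling L

  superEdgeMagic : SuperEdgeMagic G → SuperEdgeMagic G'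
  superEdgeMagic (p , q , countV , countE , L , vertexRange , vertexOnto) =
    p * S , q * S , layeredCount vertexLayers countV , layeredCount edgeLayers countE ,
    liftedLabeling , Numbering.inRange vertices , Numbering.onto vertices
    where
    open Lift L using (liftedLabeling; liftedVertexNumbering)
    vertices = liftedVertexNumbering vertexRange vertexOnto

module S2nCover (s t n : ℕ) (A h1 h2 : Fin s → Fin t → Bool) (D : Decomposition A h1 h2) where
  open Decidable⇒UIP _≟ᵇ_ using (≡-irrelevant)

  G G' : Graph
  G  = BipGraph s t A
  G' = S2n s t n A h1 h2

  vertexLayers : V G' ↔ (V G × Fin (suc n))
  vertexLayers = mk↔ₛ′ layer unlayer layer∘unlayer unlayer∘layer
    where
    layer : V G' → V G × Fin (suc n)
    layer (inj₁ v)       = v , fzero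
    layer (inj₂ (k , v)) = v , fsuc k
    unlayer : V G × Fin (suc n) → V G'
    unlayer (v , fzero)  = inj₁ v
    unlayer (v , fsuc k) = inj₂ (k , v)
    layer∘unlayer : ∀ w → layer (unlayer w) ≡ w
    layer∘unlayer (v , fzero)  = refl
    layer∘unlayer (v , fsuc k) = refl
    unlayer∘layer : ∀ v → unlayer (layer v) ≡ v
    unlayer∘layer (inj₁ v)       = refl
    unlayer∘layer (inj₂ (k , v)) = refl

  h1⇒A : ∀ i j → h1 i j ≡ true → A i j ≡ true
  h1⇒A i j h1ij = trans (proj₁ (D i j)) (cong (_∨ h2 i j) h1ij)

  h2⇒A : ∀ i j → h2 i j ≡ true → A i j ≡ true
  h2⇒A i j h2ij = trans (proj₁ (D i j)) (trans (cong (h1 i j ∨_) h2ij) (∨-zeroʳ (h1 i j)))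

  A∖h1⇒h2 : ∀ i j → A i j ≡ true → h1 i j ≡ false → h2 i j ≡ true
  A∖h1⇒h2 i j Aij ¬h1ij = trans (cong (_∨ h2 i j) (sym ¬h1ij)) (trans (sym (proj₁ (D i j))) Aij)

  layerE : E G' → E G × Fin (suc n)
  layerE (inj₁ e)                        = e , fzero
  layerE (inj₂ (inj₁ (k , (ij , h1ij)))) = (ij , h1⇒A _ _ h1ij) , fsuc k
  layerE (inj₂ (inj₂ (k , (ij , h2ij)))) = (ij , h2⇒A _ _ h2ij) , fsuc k

  copy : Fin n → ∀ i j → A i j ≡ true → (b : Bool) → h1 i j ≡ b → E G'
  copy k i j Aij true  h1ij  = inj₂ (inj₁ (k , ((i , j) , h1ij)))
  copy k i j Aij false ¬h1ij = inj₂ (inj₂ (k , ((i , j) , A∖h1⇒h2 i j Aij ¬h1ij)))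

  unlayerE : E G × Fin (suc n) → E G'
  unlayerE (e , fzero)                 = inj₁ e
  unlayerE (((i , j) , Aij) , fsuc k) = copy k i j Aij (h1 i j) refl

  layer∘copy : ∀ k i j Aij b (h1ij : h1 i j ≡ b) → layerE (copy k i j Aij b h1ij) ≡ (((i , j) , Aij) , fsuc k)
  layer∘copy k i j Aij true  _ = cong (λ z → ((i , j) , z) , fsuc k) (≡-irrelevant _ _)
  layer∘copy k i j Aij false _ = cong (λ z → ((i , j) , z) , fsuc k) (≡-irrelevant _ _)

  copyH1 : ∀ k i j h1ij Aij b (eq : h1 i j ≡ b) → copy k i j Aij b eq ≡ inj₂ (inj₁ (k , ((i , j) , h1ij)))
  copyH1 k i j h1ij Aij true  _   = cong (λ z → inj₂ (inj₁ (k , ((i , j) , z)))) (≡-irrelevant _ _)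
  copyH1 k i j h1ij Aij false eq with trans (sym h1ij) eq
  ... | ()

  copyH2 : ∀ k i j h2ij Aij b (eq : h1 i j ≡ b) → copy k i j Aij b eq ≡ inj₂ (inj₂ (k , ((i , j) , h2ij)))
  copyH2 k i j h2ij Aij true  eq with trans (sym (cong₂ _∧_ eq h2ij)) (proj₂ (D i j))
  ... | ()
  copyH2 k i j h2ij Aij false _ = cong (λ z → inj₂ (inj₂ (k , ((i , j) , z)))) (≡-irrelevant _ _)

  edgeLayers : E G' ↔ (E G × Fin (suc n))
  edgeLayers = mk↔ₛ′ layerE unlayerE layer∘unlayer unlayer∘layer
    where
    layer∘unlayer : ∀ w → layerE (unlayerE w) ≡ w
    layer∘unlayer (e , fzero)                 = refl
    layer∘unlayer (((i , j) , Aij) , fsuc k) = layer∘copy k i j Aij (h1 i j) refl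
    unlayer∘layer : ∀ e → unlayerE (layerE e) ≡ e
    unlayer∘layer (inj₁ e)                              = refl
    unlayer∘layer (inj₂ (inj₁ (k , ((i , j) , h1ij)))) = copyH1 k i j h1ij _ (h1 i j) refl
    unlayer∘layer (inj₂ (inj₂ (k , ((i , j) , h2ij)))) = copyH2 k i j h2ij _ (h1 i j) refl

  s2nCover : LayeredCover G G' n
  s2nCover = record
    { vertexLayers = vertexLayers
    ; edgeLayers   = edgeLayers
    ; tailOver     = tailOver
    ; headOver     = headOver
    ; layersAdd    = layersAdd
    }
    where
    tailOver : ∀ e → proj₁ (to vertexLayers (proj₁ (ends G' e))) ≡ proj₁ (ends G (proj₁ (to edgeLayers e)))
    tailOver (inj₁ _)                = refl
    tailOver (inj₂ (inj₁ (_ , _))) = refl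
    tailOver (inj₂ (inj₂ (_ , _))) = refl
    headOver : ∀ e → proj₁ (to vertexLayers (proj₂ (ends G' e))) ≡ proj₂ (ends G (proj₁ (to edgeLayers e)))
    headOver (inj₁ _)                = refl
    headOver (inj₂ (inj₁ (_ , _))) = refl
    headOver (inj₂ (inj₂ (_ , _))) = refl
    -- x_i y_j^k and x_i^k y_j join layers 0 and k + 1 and lie in layer k + 1.
    layersAdd : ∀ e → toℕ (proj₂ (to vertexLayers (proj₁ (ends G' e))))
                      + toℕ (proj₂ (to vertexLayers (proj₂ (ends G' e))))
                      ≡ toℕ (proj₂ (to edgeLayers e))
    layersAdd (inj₁ _)                = refl
    layersAdd (inj₂ (inj₁ (_ , _))) = refl
    layersAdd (inj₂ (inj₂ (_ , _))) = +-identityʳ _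

theorem3p4 : (s t n : ℕ) → 1 ≤ n → (A h1 h2 : Fin s → Fin t → Bool) →
    Decomposition A h1 h2 →
    (EdgeMagic (BipGraph s t A) → EdgeMagic (S2n s t n A h1 h2)) ×
    (SuperEdgeMagic (BipGraph s t A) → SuperEdgeMagic (S2n s t n A h1 h2))
theorem3p4 s t n _ A h1 h2 D = edgeMagic , superEdgeMagic
  where open Transfer (S2nCover.s2nCover s t n A h1 h2 D)
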